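{- Let $\Phi$ be one of the root systems $A_n$, $C_n$ or $D_4$. Let $P$ be a proper alcoved polytope and let $a,b\in P\cap N$. Then $u(a,b)\in P$ and $v(a,b)\in P$.
   Context: Root system data. - $\Phi$ is an irreducible crystallographic root system spanning a real Euclidean space $V$. - $\omega_i$ are the fundamental coweights, $\theta$ is the highest root, and $a_i=(\omega_i,\theta)$. Alcoves and alcoved polytopes. - Alcoves are the connected components of $V\setminus\bigcup_{\alpha\in\Phi,k\in\mathbb{Z}}\{(\lambda,\alpha)=k\}$. - A proper alcoved polytope is a full-dimensional bounded intersection of finitely many half-spaces $\{(\lambda,\alpha)\ge k\}$, $\alpha\in\Phi$, $k\in\mathbb{Z}$. The vertex set $N$. - $N$ is the set of vertices of alcoves (the vertices of the affine Coxeter arrangement). - For these root systems, $N$ is a lattice spanned by $c_i=\omega_i/a_i$. The points $u(a,b),v(a,b)$. - For $a,b\in N$, $(a+b)/2$ either lies in $N$, or lies in the relative interior of a unique edge (1-dimensional face of an alcove) and is the midpoint of that edge's two endpoints. - In the first case $u(a,b)=v(a,b)=(a+b)/2$; otherwise $u(a,b),v(a,b)$ are the two endpoints of that edge. -}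

module Defs where

open import Data.Nat as ℕ using (ℕ; zero; suc; _≤ᵇ_; _<ᵇ_; _≡ᵇ_)
open import Data.Integer as ℤ using (ℤ; +_; -_)
open import Data.Rational as ℚ using (ℚ; _/_; ½)
open import Data.Fin using (Fin; toℕ) renaming (zero to fz; suc to fs)
open import Data.Bool using (Bool; true; false; if_then_else_; _∧_)
open import Data.List using (List; []; _∷_)
open import Data.List.Relation.Unary.All using (All)
open import Data.List.Relation.Unary.Any using (Any)
open import Data.Product using (Σ; ∃; _×_; _,_)
open import Data.Sum using (_⊎_)
open import Relation.Binary.PropositionalEquality using (_≡_)
open import Relation.Nullary using (¬_)

-- A point λ ∈ V is recorded by its pairings with the
-- simple roots, y i = (λ , α_i), i.e. λ = Σ_i y i · ω_i (ω_i the
-- fundamental coweights, dual to the simple roots).  A root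
-- α = Σ_j m_j α_j is recorded by its coefficient vector m : Fin n → ℤ.
-- Then (λ , α) = Σ_j m_j · y j.

Point : ℕ → Set
Point n = Fin n → ℚ

Coeffs : ℕ → Set
Coeffs n = Fin n → ℤ

∑ : ∀ {n} → (Fin n → ℚ) → ℚ
∑ {zero}  f = ℚ.0ℚ
∑ {suc n} f = f fz ℚ.+ ∑ (λ i → f (fs i))

ℤ→ℚ : ℤ → ℚ
ℤ→ℚ z = z / 1

⟪_,_⟫ : ∀ {n} → Point n → Coeffs n → ℚ
⟪ y , m ⟫ = ∑ (λ j → ℤ→ℚ (m j) ℚ.* y j)

data RootSystem : ℕ → Set where
  A  : (m : ℕ) → RootSystem (suc m)
  C  : (m : ℕ) → RootSystem (suc (suc m))
  D4 : RootSystem 4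

b2z : Bool → ℤ
b2z true  = + 1
b2z false = + 0

-- A_n : positive roots α_i + … + α_j  (i ≤ j), 0-indexed
coeffA : ℕ → ℕ → ℕ → ℤ
coeffA i j k = b2z ((i ≤ᵇ k) ∧ (k ≤ᵇ j))

-- C_n (n = rank), simple roots α_0 … α_{n-2} short (e_k - e_{k+1}),
-- α_{n-1} = 2 e_{n-1} long.  e-indices 0 … n-1.
-- e_i - e_j (i < j)
coeffC⁻ : ℕ → ℕ → ℕ → ℤ
coeffC⁻ i j k = b2z ((i ≤ᵇ k) ∧ (k <ᵇ j))

-- e_i + e_j (i < j ≤ n-1)
coeffC⁺ : ℕ → ℕ → ℕ → ℕ → ℤ
coeffC⁺ n i j k =
  if (suc k ≡ᵇ n) then + 1
  else if ((i ≤ᵇ k) ∧ (k <ᵇ j)) then + 1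
  else if (j ≤ᵇ k) then + 2
  else + 0

-- 2 e_i
coeffC² : ℕ → ℕ → ℕ → ℤ
coeffC² n i k =
  if (suc k ≡ᵇ n) then + 1
  else if (i ≤ᵇ k) then + 2
  else + 0

-- D_4, simple roots α_0, α_1 (central node), α_2, α_3
vec4 : ℤ → ℤ → ℤ → ℤ → Coeffs 4
vec4 a b c d fz = a
vec4 a b c d (fs fz) = b
vec4 a b c d (fs (fs fz)) = c
vec4 a b c d (fs (fs (fs fz))) = d

posRootsD4 : List (Coeffs 4)
posRootsD4 =
  vec4 (+ 1) (+ 0) (+ 0) (+ 0) ∷ vec4 (+ 0) (+ 1) (+ 0) (+ 0) ∷
  vec4 (+ 0) (+ 0) (+ 1) (+ 0) ∷ vec4 (+ 0) (+ 0) (+ 0) (+ 1) ∷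
  vec4 (+ 1) (+ 1) (+ 0) (+ 0) ∷ vec4 (+ 0) (+ 1) (+ 1) (+ 0) ∷
  vec4 (+ 0) (+ 1) (+ 0) (+ 1) ∷ vec4 (+ 1) (+ 1) (+ 1) (+ 0) ∷
  vec4 (+ 1) (+ 1) (+ 0) (+ 1) ∷ vec4 (+ 0) (+ 1) (+ 1) (+ 1) ∷
  vec4 (+ 1) (+ 1) (+ 1) (+ 1) ∷ vec4 (+ 1) (+ 2) (+ 1) (+ 1) ∷ []

_≐_ : ∀ {n} → Coeffs n → Coeffs n → Set
α ≐ β = ∀ k → α k ≡ β k

IsPosRoot : ∀ {n} → RootSystem n → Coeffs n → Set
IsPosRoot (A m) α =
  Σ ℕ λ i → Σ ℕ λ j → (i ℕ.≤ j) × (j ℕ.< suc m) × (α ≐ λ k → coeffA i j (toℕ k))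
IsPosRoot (C m) α =
  (Σ ℕ λ i → Σ ℕ λ j → (i ℕ.< j) × (j ℕ.< suc (suc m))
     × (α ≐ λ k → coeffC⁻ i j (toℕ k)))
  ⊎ ((Σ ℕ λ i → Σ ℕ λ j → (i ℕ.< j) × (j ℕ.< suc (suc m))
       × (α ≐ λ k → coeffC⁺ (suc (suc m)) i j (toℕ k)))
  ⊎ (Σ ℕ λ i → (i ℕ.< suc (suc m))
       × (α ≐ λ k → coeffC² (suc (suc m)) i (toℕ k))))
IsPosRoot D4 α = Any (λ β → α ≐ β) posRootsD4

IsRoot : ∀ {n} → RootSystem n → Coeffs n → Set
IsRoot Φ α = IsPosRoot Φ α ⊎ IsPosRoot Φ (λ k → - α k)

-- a_i = (ω_i , θ) = coefficient of α_i in the highest root θ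
mark : ∀ {n} → RootSystem n → Fin n → ℕ
mark (A m) i = 1
mark (C m) i = if (suc (toℕ i) ≡ᵇ suc (suc m)) then 1 else 2
mark D4 i = vecM i
  where
  vecM : Fin 4 → ℕ
  vecM (fs fz) = 2
  vecM _ = 1

-- N : the lattice spanned by c_i = ω_i / a_i, i.e. λ = Σ z_i ω_i / a_i
-- with z_i ∈ ℤ, i.e. a_i · (λ , α_i) ∈ ℤ for all i.

InN : ∀ {n} → RootSystem n → Point n → Set
InN Φ y = ∀ i → Σ ℤ λ z → ℤ→ℚ (+ mark Φ i) ℚ.* y i ≡ ℤ→ℚ z

mid : ∀ {n} → Point n → Point n → Point n
mid a b i = ½ ℚ.* (a i ℚ.+ b i)

_≗_ : ∀ {n} → Point n → Point n → Set
x ≗ y = ∀ i → x i ≡ y i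

-- Alcoves.  Every alcove is a (nonempty) set
--   { λ : k_α < (λ,α) < k_α + 1  for all positive roots α }
-- for some integers k_α; its closure is the simplex obtained with ≤.

-- y lies in the closure of the alcove containing the generic point p,
-- where k records the integers k_α
InClosedAlcove : ∀ {n} → RootSystem n → Point n → (Coeffs n → ℤ) → Point n → Set
InClosedAlcove Φ p k y =
  ∀ α → IsPosRoot Φ α →
    (ℤ→ℚ (k α) ℚ.≤ ⟪ y , α ⟫) × (⟪ y , α ⟫ ℚ.≤ ℤ→ℚ (k α ℤ.+ + 1))

IsAlcovePoint : ∀ {n} → RootSystem n → Point n → (Coeffs n → ℤ) → Set
IsAlcovePoint Φ p k =
  ∀ α → IsPosRoot Φ α →
    (ℤ→ℚ (k α) ℚ.< ⟪ p , α ⟫) × (⟪ p , α ⟫ ℚ.< ℤ→ℚ (k α ℤ.+ + 1))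

-- u and v are the two (distinct) endpoints of an edge of some alcove:
-- both are vertices (points of N) of the closure of a common alcove
-- (an alcove closure is a simplex, so any two distinct vertices span an edge).
IsAlcoveEdge : ∀ {n} → RootSystem n → Point n → Point n → Set
IsAlcoveEdge {n} Φ u v =
  InN Φ u × InN Φ v × ¬ (u ≗ v) ×
  (Σ (Point n) λ p → Σ (Coeffs n → ℤ) λ k →
     IsAlcovePoint Φ p k × InClosedAlcove Φ p k u × InClosedAlcove Φ p k v)

record HalfSpace {n : ℕ} (Φ : RootSystem n) : Set where
  constructor halfSpace
  field
    root   : Coeffs n
    isRoot : IsRoot Φ root
    bound  : ℤ

AlcovedPolytope : ∀ {n} → RootSystem n → Set
AlcovedPolytope Φ = List (HalfSpace Φ)

_∈P_ : ∀ {n} {Φ : RootSystem n} → Point n → AlcovedPolytope Φ → Set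
y ∈P P = All (λ h → ℤ→ℚ (HalfSpace.bound h) ℚ.≤ ⟪ y , HalfSpace.root h ⟫) P

FullDimensional : ∀ {n} {Φ : RootSystem n} → AlcovedPolytope Φ → Set
FullDimensional {n} P =
  Σ (Point n) λ y →
    All (λ h → ℤ→ℚ (HalfSpace.bound h) ℚ.< ⟪ y , HalfSpace.root h ⟫) P

Bounded : ∀ {n} {Φ : RootSystem n} → AlcovedPolytope Φ → Set
Bounded {n} P = Σ ℚ λ M → ∀ (y : Point n) → y ∈P P → ∀ i → ℚ.∣ y i ∣ ℚ.≤ M

Proper : ∀ {n} {Φ : RootSystem n} → AlcovedPolytope Φ → Set
Proper P = FullDimensional P × Bounded P

-- Each root α gives an affine function (λ , α) which, on the closure of an
-- alcove, takes values in a unit interval [L , L + 1] with L an integer.  The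
-- endpoints u, v of an alcove edge lie in a common closed alcove, and
-- u + v = a + b.  If two numbers lie in a common unit interval with integer
-- ends and their sum is at least 2k for an integer k, both are at least k; so
-- every inequality (λ , α) ≥ k defining P that holds at a and b holds at u
-- and v.  The case (a + b)/2 ∈ N is plain convexity.

module Submission where

open import Defs
open import Data.Nat using (ℕ)
open import Data.Product using (_×_)
open import Relation.Nullary using (¬_)

open import Data.Fin using (Fin) renaming (zero to fz; suc to fs)
open import Data.Integer as ℤ using (ℤ; 1ℤ)
import Data.Integer.Properties as ℤ
import Data.Integer.Solver as ℤ-Solver
import Data.List.Relation.Unary.All as All
open import Data.Nat.Coprimality using (1-coprimeTo) renaming (sym to coprime-sym)
open import Data.Product using (_,_; uncurry)
open import Data.Rational as ℚ using (ℚ; mkℚ; ½; _≤_; _+_; _*_; -_)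
open import Data.Rational.Properties
open import Algebra.Properties.Group +-0-group using (⁻¹-involutive)
import Data.Rational.Solver as ℚ-Solver
open import Data.Sum using (inj₁; inj₂)
open import Relation.Binary.PropositionalEquality hiding (_≗_)
open import Relation.Nullary using (yes; no)

ℤ→ℚ-mkℚ : ∀ z → ℤ→ℚ z ≡ mkℚ z 0 (coprime-sym (1-coprimeTo ℤ.∣ z ∣))
ℤ→ℚ-mkℚ z = ↥p/↧p≡p (mkℚ z 0 (coprime-sym (1-coprimeTo ℤ.∣ z ∣)))

ℤ→ℚ-mono-≤ : ∀ {z w} → z ℤ.≤ w → ℤ→ℚ z ≤ ℤ→ℚ w
ℤ→ℚ-mono-≤ {z} {w} z≤w rewrite ℤ→ℚ-mkℚ z | ℤ→ℚ-mkℚ w =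
  ℚ.*≤* (subst₂ ℤ._≤_ (sym (ℤ.*-identityʳ z)) (sym (ℤ.*-identityʳ w)) z≤w)

ℤ→ℚ-neg : ∀ z → ℤ→ℚ (ℤ.- z) ≡ - ℤ→ℚ z
ℤ→ℚ-neg z =
  trans (ℤ→ℚ-mkℚ (ℤ.- z)) (trans (mkℚ-neg z) (cong -_ (sym (ℤ→ℚ-mkℚ z))))
  where
  mkℚ-neg : ∀ z → mkℚ (ℤ.- z) 0 (coprime-sym (1-coprimeTo ℤ.∣ ℤ.- z ∣))
                  ≡ - mkℚ z 0 (coprime-sym (1-coprimeTo ℤ.∣ z ∣))
  mkℚ-neg (ℤ.+ 0)        = refl
  mkℚ-neg ℤ.+[1+ n ]     = refl
  mkℚ-neg ℤ.-[1+ n ]     = refl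

∑-cong : ∀ {n} {f g : Fin n → ℚ} → (∀ i → f i ≡ g i) → ∑ f ≡ ∑ g
∑-cong {ℕ.zero}  f≗g = refl
∑-cong {ℕ.suc n} f≗g = cong₂ _+_ (f≗g fz) (∑-cong (λ i → f≗g (fs i)))

∑-+ : ∀ {n} (f g : Fin n → ℚ) → ∑ (λ i → f i + g i) ≡ ∑ f + ∑ g
∑-+ {ℕ.zero}  f g = refl
∑-+ {ℕ.suc n} f g =
  trans (cong (f fz + g fz +_) (∑-+ (λ i → f (fs i)) (λ i → g (fs i))))
        (interchange (f fz) (g fz) (∑ (λ i → f (fs i))) (∑ (λ i → g (fs i))))
  where
  open ℚ-Solver.+-*-Solver
  interchange : ∀ w x y z → (w + x) + (y + z) ≡ (w + y) + (x + z)
  interchange = solve 4 (λ w x y z → (w :+ x) :+ (y :+ z) := (w :+ y) :+ (x :+ z)) refl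

∑-*ˡ : ∀ {n} (c : ℚ) (f : Fin n → ℚ) → ∑ (λ i → c * f i) ≡ c * ∑ f
∑-*ˡ {ℕ.zero}  c f = sym (*-zeroʳ c)
∑-*ˡ {ℕ.suc n} c f =
  trans (cong (c * f fz +_) (∑-*ˡ c (λ i → f (fs i))))
        (sym (*-distribˡ-+ c (f fz) (∑ (λ i → f (fs i)))))

∑-neg : ∀ {n} (f : Fin n → ℚ) → ∑ (λ i → - f i) ≡ - ∑ f
∑-neg {ℕ.zero}  f = refl
∑-neg {ℕ.suc n} f =
  trans (cong (- f fz +_) (∑-neg (λ i → f (fs i))))
        (sym (neg-distrib-+ (f fz) (∑ (λ i → f (fs i)))))

pairing-mid : ∀ {n} (a b : Point n) (α : Coeffs n) →
  ⟪ mid a b , α ⟫ ≡ ½ * (⟪ a , α ⟫ + ⟪ b , α ⟫)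
pairing-mid a b α = begin
  ∑ (λ j → m j * (½ * (a j + b j)))    ≡⟨ ∑-cong (λ j → distrib (m j) (a j) (b j)) ⟩
  ∑ (λ j → ½ * (m j * a j + m j * b j)) ≡⟨ ∑-*ˡ ½ (λ j → m j * a j + m j * b j) ⟩
  ½ * ∑ (λ j → m j * a j + m j * b j)   ≡⟨ cong (½ *_) (∑-+ (λ j → m j * a j) (λ j → m j * b j)) ⟩
  ½ * (⟪ a , α ⟫ + ⟪ b , α ⟫)           ∎
  where
  open ≡-Reasoning
  open ℚ-Solver.+-*-Solver
  m = λ j → ℤ→ℚ (α j)
  distrib : ∀ c x y → c * (½ * (x + y)) ≡ ½ * (c * x + c * y)
  distrib = solve 3 (λ c x y → c :* (con ½ :* (x :+ y)) := con ½ :* (c :* x :+ c :* y)) refl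

pairing-cong : ∀ {n} {x y : Point n} → x ≗ y → (α : Coeffs n) → ⟪ x , α ⟫ ≡ ⟪ y , α ⟫
pairing-cong x≗y α = ∑-cong (λ j → cong (ℤ→ℚ (α j) *_) (x≗y j))

mid-≗⇒pairing-+-≡ : ∀ {n} {u v a b : Point n} → mid u v ≗ mid a b → (α : Coeffs n) →
  ⟪ u , α ⟫ + ⟪ v , α ⟫ ≡ ⟪ a , α ⟫ + ⟪ b , α ⟫
mid-≗⇒pairing-+-≡ {u = u} {v} {a} {b} uv≗ab α = begin
  ⟪ u , α ⟫ + ⟪ v , α ⟫            ≡⟨ sym (2[½x]≡x _) ⟩
  2ℚ * (½ * (⟪ u , α ⟫ + ⟪ v , α ⟫)) ≡⟨ cong (2ℚ *_) (sym (pairing-mid u v α)) ⟩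
  2ℚ * ⟪ mid u v , α ⟫              ≡⟨ cong (2ℚ *_) (pairing-cong uv≗ab α) ⟩
  2ℚ * ⟪ mid a b , α ⟫              ≡⟨ cong (2ℚ *_) (pairing-mid a b α) ⟩
  2ℚ * (½ * (⟪ a , α ⟫ + ⟪ b , α ⟫)) ≡⟨ 2[½x]≡x _ ⟩
  ⟪ a , α ⟫ + ⟪ b , α ⟫            ∎
  where
  open ≡-Reasoning
  open ℚ-Solver.+-*-Solver
  2ℚ = ℚ.1ℚ + ℚ.1ℚ
  2[½x]≡x : ∀ x → 2ℚ * (½ * x) ≡ x
  2[½x]≡x = solve 1 (λ x → con 2ℚ :* (con ½ :* x) := x) refl

pairing-neg : ∀ {n} (y : Point n) (α : Coeffs n) →
  ⟪ y , (λ j → ℤ.- α j) ⟫ ≡ - ⟪ y , α ⟫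
pairing-neg y α = begin
  ∑ (λ j → ℤ→ℚ (ℤ.- α j) * y j)   ≡⟨ ∑-cong (λ j → cong (_* y j) (ℤ→ℚ-neg (α j))) ⟩
  ∑ (λ j → - ℤ→ℚ (α j) * y j)     ≡⟨ ∑-cong (λ j → sym (neg-distribˡ-* (ℤ→ℚ (α j)) (y j))) ⟩
  ∑ (λ j → - (ℤ→ℚ (α j) * y j))   ≡⟨ ∑-neg (λ j → ℤ→ℚ (α j) * y j) ⟩
  - ⟪ y , α ⟫                     ∎
  where open ≡-Reasoning

≤-average : ∀ {c s t} → c ≤ s → c ≤ t → c ≤ ½ * (s + t)
≤-average {c} {s} {t} c≤s c≤t =
  subst (_≤ ½ * (s + t)) (½[x+x]≡x c) (*-monoˡ-≤-nonNeg ½ (+-mono-≤ c≤s c≤t))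
  where
  open ℚ-Solver.+-*-Solver
  ½[x+x]≡x : ∀ x → ½ * (x + x) ≡ x
  ½[x+x]≡x = solve 1 (λ x → con ½ :* (x :+ x) := x) refl

record InUnitInterval (L : ℤ) (x : ℚ) : Set where
  constructor unitInterval
  field
    lower : ℤ→ℚ L ≤ x
    upper : x ≤ ℤ→ℚ (L ℤ.+ 1ℤ)

InUnitInterval-neg : ∀ {L x} → InUnitInterval L (- x) → InUnitInterval (ℤ.- (L ℤ.+ 1ℤ)) x
InUnitInterval-neg {L} {x} (unitInterval L≤-x -x≤L+1) = unitInterval
  (subst₂ _≤_ (sym (ℤ→ℚ-neg (L ℤ.+ 1ℤ))) (⁻¹-involutive x) (neg-antimono-≤ -x≤L+1))
  (subst₂ _≤_ (⁻¹-involutive x) (trans (sym (ℤ→ℚ-neg L)) (cong ℤ→ℚ (sym (-[L+1]+1≡-L L))))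
    (neg-antimono-≤ L≤-x))
  where
  open ℤ-Solver.+-*-Solver
  -[L+1]+1≡-L : ∀ L → ℤ.- (L ℤ.+ 1ℤ) ℤ.+ 1ℤ ≡ ℤ.- L
  -[L+1]+1≡-L = solve 1 (λ L → :- (L :+ con 1ℤ) :+ con 1ℤ := :- L) refl

-- Since k is an integer, either k ≤ L ≤ x, or k ≥ L + 1 ≥ y and then
-- x < k would force x + y < k + k ≤ s + t.
unitInterval-sum-lowerBound : ∀ (k : ℤ) {L x y s t} →
  InUnitInterval L x → InUnitInterval L y → x + y ≡ s + t →
  ℤ→ℚ k ≤ s → ℤ→ℚ k ≤ t → ℤ→ℚ k ≤ x
unitInterval-sum-lowerBound k {L} {y = y}
  (unitInterval L≤x _) (unitInterval _ y≤L+1) x+y≡s+t k≤s k≤t with k ℤ.≤? L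
... | yes k≤L = ≤-trans (ℤ→ℚ-mono-≤ k≤L) L≤x
... | no  k≰L = ≮⇒≥ λ x<k → <-irrefl refl (<-≤-trans (+-mono-<-≤ x<k y≤k)
        (subst (ℤ→ℚ k + ℤ→ℚ k ≤_) (sym x+y≡s+t) (+-mono-≤ k≤s k≤t)))
  where
  L+1≤k : L ℤ.+ 1ℤ ℤ.≤ k
  L+1≤k = subst (ℤ._≤ k) (ℤ.+-comm 1ℤ L) (ℤ.i<j⇒suc[i]≤j (ℤ.≰⇒> k≰L))
  y≤k : y ≤ ℤ→ℚ k
  y≤k = ≤-trans y≤L+1 (ℤ→ℚ-mono-≤ L+1≤k)

module _ {n : ℕ} {Φ : RootSystem n} where

  stripIndex : {α : Coeffs n} → IsRoot Φ α → (Coeffs n → ℤ) → ℤ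
  stripIndex {α} (inj₁ _) K = K α
  stripIndex {α} (inj₂ _) K = ℤ.- (K (λ j → ℤ.- α j) ℤ.+ 1ℤ)

  closedAlcove-unitInterval : ∀ {α y} p K (α∈Φ : IsRoot Φ α) →
    InClosedAlcove Φ p K y → InUnitInterval (stripIndex α∈Φ K) ⟪ y , α ⟫
  closedAlcove-unitInterval {α} p K (inj₁ α∈Φ⁺) y∈A = uncurry unitInterval (y∈A α α∈Φ⁺)
  closedAlcove-unitInterval {α} {y} p K (inj₂ -α∈Φ⁺) y∈A =
    InUnitInterval-neg (subst (InUnitInterval (K (λ j → ℤ.- α j))) (pairing-neg y α)
                              (uncurry unitInterval (y∈A _ -α∈Φ⁺)))

  _∈H_ : Point n → HalfSpace Φ → Set
  y ∈H h = ℤ→ℚ (HalfSpace.bound h) ≤ ⟪ y , HalfSpace.root h ⟫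

  ∈H-mid : ∀ (h : HalfSpace Φ) {a b} → a ∈H h → b ∈H h → mid a b ∈H h
  ∈H-mid (halfSpace α _ k) {a} {b} a∈h b∈h =
    subst (ℤ→ℚ k ≤_) (sym (pairing-mid a b α)) (≤-average a∈h b∈h)

  ∈H-alcoveEdge : ∀ (h : HalfSpace Φ) {a b u v} p K →
    InClosedAlcove Φ p K u → InClosedAlcove Φ p K v → mid u v ≗ mid a b →
    a ∈H h → b ∈H h → (u ∈H h) × (v ∈H h)
  ∈H-alcoveEdge (halfSpace α α∈Φ k) {a} {b} {u} {v} p K u∈A v∈A uv≗ab a∈h b∈h =
    unitInterval-sum-lowerBound k u∈I v∈I u+v≡a+b a∈h b∈h ,
    unitInterval-sum-lowerBound k v∈I u∈I (trans (+-comm ⟪ v , α ⟫ ⟪ u , α ⟫) u+v≡a+b) a∈h b∈h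
    where
    u∈I : InUnitInterval (stripIndex α∈Φ K) ⟪ u , α ⟫
    u∈I = closedAlcove-unitInterval p K α∈Φ u∈A
    v∈I : InUnitInterval (stripIndex α∈Φ K) ⟪ v , α ⟫
    v∈I = closedAlcove-unitInterval p K α∈Φ v∈A
    u+v≡a+b : ⟪ u , α ⟫ + ⟪ v , α ⟫ ≡ ⟪ a , α ⟫ + ⟪ b , α ⟫
    u+v≡a+b = mid-≗⇒pairing-+-≡ uv≗ab α

mainTheorem20 : ∀ {n : ℕ} (Φ : RootSystem n) (P : AlcovedPolytope Φ) →
    Proper P → (a b : Point n) → InN Φ a → InN Φ b → a ∈P P → b ∈P P →
    (InN Φ (mid a b) → mid a b ∈P P)
    × (∀ (u v : Point n) → ¬ InN Φ (mid a b) → IsAlcoveEdge Φ u v →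
    mid u v ≗ mid a b → (u ∈P P) × (v ∈P P))
mainTheorem20 Φ P _ a b _ _ a∈P b∈P = mid∈P , uv∈P
  where
  mid∈P : InN Φ (mid a b) → mid a b ∈P P
  mid∈P _ = All.zipWith (λ {h} → uncurry (∈H-mid h)) (a∈P , b∈P)

  uv∈P : ∀ u v → ¬ InN Φ (mid a b) → IsAlcoveEdge Φ u v →
         mid u v ≗ mid a b → (u ∈P P) × (v ∈P P)
  uv∈P u v _ (_ , _ , _ , p , K , _ , u∈A , v∈A) uv≗ab =
    All.unzip (All.zipWith (λ {h} → uncurry (∈H-alcoveEdge h p K u∈A v∈A uv≗ab)) (a∈P , b∈P))
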